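{- Let $\mathcal{P}$ be a Fitting program over a bilattice $\mathcal{B}$ as in the context, and $\alpha\in\{\mathcal{F},\mathcal{T},\mathcal{U},\mathcal{I}\}$, and write $f=\Psi'^{\alpha}_{\mathcal{P}}$. Then $f$ has two extreme oscillation points $Fix^{\alpha}_{\mathcal{F}}$ and $Fix^{\alpha}_{\mathcal{T}}$ under the truth ordering, with $Fix^{\alpha}_{\mathcal{F}}\leq_t Fix^{\alpha}_{\mathcal{T}}$; that is: $Fix^{\alpha}_{\mathcal{F}}$ and $Fix^{\alpha}_{\mathcal{T}}$ are the $\leq_t$-least and $\leq_t$-greatest fixpoints of $f\circ f$; $f(Fix^{\alpha}_{\mathcal{F}})=Fix^{\alpha}_{\mathcal{T}}$ and $f(Fix^{\alpha}_{\mathcal{T}})=Fix^{\alpha}_{\mathcal{F}}$; and whenever $x,y\in\mathcal{V}(\mathcal{B})$ satisfy $f(x)=y$ and $f(y)=x$, both $x$ and $y$ lie between $Fix^{\alpha}_{\mathcal{F}}$ and $Fix^{\alpha}_{\mathcal{T}}$ in $\leq_t$.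
   Context: A bilattice $\langle \mathcal{B},\leq_t,\leq_k\rangle$ is a nonempty set with two partial orders, each making $\mathcal{B}$ a complete lattice. Meet/join under $\leq_t$ are $\wedge,\vee$ (infinitary $\bigwedge,\bigvee$); under $\leq_k$ are $\otimes,\oplus$ (infinitary $\bigotimes,\bigoplus$). Bottom/top under $\leq_t$ are $\mathcal{F},\mathcal{T}$; under $\leq_k$ are $\mathcal{U},\mathcal{I}$. Standing assumptions: $\mathcal{B}$ is infinitely distributive, satisfies the infinitary interlacing conditions (each of $\wedge,\vee,\otimes,\oplus$ and their infinitary versions is monotone with respect to both orderings), and has a negation $\neg$ (an involution reversing $\leq_t$ and preserving $\leq_k$). Fitting program: formulas are built from literals (atoms and negated atoms) and elements of $\mathcal{B}$ using $\wedge,\vee,\otimes,\oplus,\exists,\forall$; a clause is $P(x_1,\dots,x_n)\leftarrow\phi(x_1,\dots,x_n)$ with free variables of $\phi$ among the $x_i$; a program is a finite set of clauses with no predicate letter heading more than one clause. Inst-$\mathcal{P}$ is the set of ground instances of its clauses. A built-in predicate $equal(s,t)$ has value $\mathcal{T}$ if $s=t$ and $\mathcal{F}$ otherwise. Valuations are maps from ground atoms to $\mathcal{B}$; $\mathcal{V}(\mathcal{B})$ is the set of valuations with pointwise orders and operations. Contrajoin $v\bigtriangleup w$ on closed formulas: $v\bigtriangleup w(A)=v(A)$, $v\bigtriangleup w(\neg A)=\neg w(A)$ for ground atoms, $v\bigtriangleup w(\beta)=\beta$ for $\beta\in\mathcal{B}$, commuting with $\wedge,\vee,\otimes,\oplus$,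 with $\exists$ as $\bigvee$ and $\forall$ as $\bigwedge$ over closed-term instances. $\Psi^{\alpha}_{\mathcal{P}}(v,w)(A)=\alpha$ if the ground atom $A$ heads no member of Inst-$\mathcal{P}$, and $=v\bigtriangleup w(B)$ if $A\leftarrow B\in$ Inst-$\mathcal{P}$. $v_\alpha$ is the constant valuation $\alpha$. $\Psi'^{\alpha}_{\mathcal{P}}(v)$ is the limit of the transfinite sequence $a_0=v_\alpha$, $a_{n}=\Psi^{\alpha}_{\mathcal{P}}(a_{n-1},v)$ at successors, and at limits $\lambda$: $a_\lambda=\bigvee_{n<\lambda}\Psi^{\alpha}_{\mathcal{P}}(a_n,v)$ if $\alpha=\mathcal{F}$, $\bigwedge_{n<\lambda}$ if $\alpha=\mathcal{T}$, $\bigoplus_{n<\lambda}$ if $\alpha=\mathcal{U}$, $\bigotimes_{n<\lambda}$ if $\alpha=\mathcal{I}$ (this is the $\leq_t$-least, $\leq_t$-greatest, $\leq_k$-least, $\leq_k$-greatest fixpoint of $x\mapsto\Psi^{\alpha}_{\mathcal{P}}(x,v)$, respectively). -}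

module Defs where

open import Level using (Level; suc; Lift; lift; lower) renaming (zero to lzero)
open import Data.Nat using (ℕ) renaming (suc to nsuc)
open import Data.Fin using (Fin)
open import Data.Vec using (Vec; []; _∷_; lookup)
open import Data.Vec.Functional using () renaming (_∷_ to _∷ᶠ_)
open import Data.List using (List)
open import Data.List.Membership.Propositional using (_∈_)
open import Data.Maybe using (Maybe; just; nothing; Is-just)
open import Data.Product using (Σ; Σ-syntax; _×_; _,_; proj₁; proj₂)
open import Data.Sum using (_⊎_)
open import Relation.Binary.PropositionalEquality using (_≡_)
open import Relation.Binary.Structures using (IsPartialOrder)
open import Relation.Binary.Lattice.Definitions using (Infimum; Supremum)
open import Relation.Binary.Definitions using (Maximum; Minimum)

module _ {ℓ : Level} {C : Set ℓ} where

  IsInfimumOf : (C → C → Set ℓ) → ({I : Set ℓ} → (I → C) → C) → Set (suc ℓ)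
  IsInfimumOf _≤_ ⨀ = ∀ {I : Set ℓ} (b : I → C) →
    (∀ i → ⨀ b ≤ b i) × (∀ z → (∀ i → z ≤ b i) → z ≤ ⨀ b)

  IsSupremumOf : (C → C → Set ℓ) → ({I : Set ℓ} → (I → C) → C) → Set (suc ℓ)
  IsSupremumOf _≤_ ⨀ = IsInfimumOf (λ x y → y ≤ x) ⨀

  InfMonotone : (C → C → Set ℓ) → ({I : Set ℓ} → (I → C) → C) → Set (suc ℓ)
  InfMonotone _≤_ ⨀ = ∀ {I : Set ℓ} (a b : I → C) → (∀ i → a i ≤ b i) → ⨀ a ≤ ⨀ b

  BinMonotone : (C → C → Set ℓ) → (C → C → C) → Set ℓ
  BinMonotone _≤_ _∘_ = ∀ {a b c d} → a ≤ b → c ≤ d → (a ∘ c) ≤ (b ∘ d)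

  -- infinite distributivity of a binary operation over an infinitary one
  -- (for nonempty families; witness i₀)
  InfDistrib : (C → C → C) → ({I : Set ℓ} → (I → C) → C) → Set (suc ℓ)
  InfDistrib _∘_ ⨀ = ∀ {I : Set ℓ} (i₀ : I) (a : C) (b : I → C) →
    (a ∘ ⨀ b) ≡ ⨀ (λ i → a ∘ b i)

record Bilattice (ℓ : Level) : Set (suc ℓ) where
  infixr 7 _∧_ _⊗_
  infixr 6 _∨_ _⊕_
  infix 4 _≤t_ _≤k_
  infix 8 ¬_
  field
    Carrier : Set ℓ
    _≤t_ _≤k_ : Carrier → Carrier → Set ℓ
    ≤t-isPartialOrder : IsPartialOrder _≡_ _≤t_
    ≤k-isPartialOrder : IsPartialOrder _≡_ _≤k_
    _∧_ _∨_ _⊗_ _⊕_ : Carrier → Carrier → Carrier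
    ∧-inf : Infimum _≤t_ _∧_
    ∨-sup : Supremum _≤t_ _∨_
    ⊗-inf : Infimum _≤k_ _⊗_
    ⊕-sup : Supremum _≤k_ _⊕_
    ⋀ ⋁ ⨂ ⨁ : {I : Set ℓ} → (I → Carrier) → Carrier
    ⋀-inf : IsInfimumOf _≤t_ ⋀
    ⋁-sup : IsSupremumOf _≤t_ ⋁
    ⨂-inf : IsInfimumOf _≤k_ ⨂
    ⨁-sup : IsSupremumOf _≤k_ ⨁
    𝐅 𝐓 𝐔 𝐈 : Carrier
    𝐅-min : Minimum _≤t_ 𝐅
    𝐓-max : Maximum _≤t_ 𝐓
    𝐔-min : Minimum _≤k_ 𝐔
    𝐈-max : Maximum _≤k_ 𝐈
    ∧-mono-k : BinMonotone _≤k_ _∧_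
    ∨-mono-k : BinMonotone _≤k_ _∨_
    ⊗-mono-t : BinMonotone _≤t_ _⊗_
    ⊕-mono-t : BinMonotone _≤t_ _⊕_
    ⋀-mono-k : InfMonotone _≤k_ ⋀
    ⋁-mono-k : InfMonotone _≤k_ ⋁
    ⨂-mono-t : InfMonotone _≤t_ ⨂
    ⨁-mono-t : InfMonotone _≤t_ ⨁
    ∧-⋁ : InfDistrib _∧_ ⋁
    ∧-⨂ : InfDistrib _∧_ ⨂
    ∧-⨁ : InfDistrib _∧_ ⨁
    ∨-⋀ : InfDistrib _∨_ ⋀
    ∨-⨂ : InfDistrib _∨_ ⨂
    ∨-⨁ : InfDistrib _∨_ ⨁
    ⊗-⋀ : InfDistrib _⊗_ ⋀
    ⊗-⋁ : InfDistrib _⊗_ ⋁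
    ⊗-⨁ : InfDistrib _⊗_ ⨁
    ⊕-⋀ : InfDistrib _⊕_ ⋀
    ⊕-⋁ : InfDistrib _⊕_ ⋁
    ⊕-⨂ : InfDistrib _⊕_ ⨂
    ¬_ : Carrier → Carrier
    ¬-involutive : ∀ a → ¬ (¬ a) ≡ a
    ¬-antitone-t : ∀ {a b} → a ≤t b → ¬ b ≤t ¬ a
    ¬-monotone-k : ∀ {a b} → a ≤k b → ¬ a ≤k ¬ b

record Signature : Set₁ where
  field
    Fun    : Set
    arity  : Fun → ℕ
    Pred   : Set
    parity : Pred → ℕ

module Fitting {ℓ : Level} (B : Bilattice ℓ) (S : Signature) where
  open Bilattice B
  open Signature S

  data Term (n : ℕ) : Set where
    var : Fin n → Term n
    fn  : (f : Fun) → Vec (Term n) (arity f) → Term n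

  ClosedTerm : Set
  ClosedTerm = Term 0

  data Atom (n : ℕ) : Set where
    pred  : (p : Pred) → Vec (Term n) (parity p) → Atom n
    equal : Term n → Term n → Atom n

  data Formula (n : ℕ) : Set ℓ where
    pos   : Atom n → Formula n
    neg   : Atom n → Formula n
    const : Carrier → Formula n
    _∧ᶠ_ _∨ᶠ_ _⊗ᶠ_ _⊕ᶠ_ : Formula n → Formula n → Formula n
    ∃ᶠ ∀ᶠ : Formula (nsuc n) → Formula n

  GroundAtom : Set
  GroundAtom = Σ Pred (λ p → Vec ClosedTerm (parity p))

  Valuation : Set ℓ
  Valuation = GroundAtom → Carrier

  _≤tᵛ_ : Valuation → Valuation → Set ℓ
  v ≤tᵛ w = ∀ A → v A ≤t w A

  _≤kᵛ_ : Valuation → Valuation → Set ℓ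
  v ≤kᵛ w = ∀ A → v A ≤k w A

  _≐_ : Valuation → Valuation → Set ℓ
  v ≐ w = ∀ A → v A ≡ w A

  mutual
    substT : ∀ {n} → (Fin n → ClosedTerm) → Term n → ClosedTerm
    substT ρ (var x)  = ρ x
    substT ρ (fn f ts) = fn f (substTs ρ ts)

    substTs : ∀ {n m} → (Fin n → ClosedTerm) → Vec (Term n) m → Vec ClosedTerm m
    substTs ρ []       = []
    substTs ρ (t ∷ ts) = substT ρ t ∷ substTs ρ ts

  -- value of the built-in equal(s,t): 𝐓 if s = t, 𝐅 otherwise
  -- (written as the join of the family {𝐓 | s = t}, which is 𝐓 if s = t and
  --  the empty join 𝐅 otherwise; this avoids assuming decidable equality)
  equalVal : ClosedTerm → ClosedTerm → Carrier
  equalVal s t = ⋁ {I = Lift ℓ (s ≡ t)} (λ _ → 𝐓)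

  atomVal : ∀ {n} → Valuation → (Fin n → ClosedTerm) → Atom n → Carrier
  atomVal v ρ (pred p ts) = v (p , substTs ρ ts)
  atomVal v ρ (equal s t) = equalVal (substT ρ s) (substT ρ t)

  contrajoin : ∀ {n} → Valuation → Valuation → (Fin n → ClosedTerm) → Formula n → Carrier
  contrajoin v w ρ (pos A)   = atomVal v ρ A
  contrajoin v w ρ (neg A)   = ¬ atomVal w ρ A
  contrajoin v w ρ (const b) = b
  contrajoin v w ρ (φ ∧ᶠ ψ)  = contrajoin v w ρ φ ∧ contrajoin v w ρ ψ
  contrajoin v w ρ (φ ∨ᶠ ψ)  = contrajoin v w ρ φ ∨ contrajoin v w ρ ψ
  contrajoin v w ρ (φ ⊗ᶠ ψ)  = contrajoin v w ρ φ ⊗ contrajoin v w ρ ψ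
  contrajoin v w ρ (φ ⊕ᶠ ψ)  = contrajoin v w ρ φ ⊕ contrajoin v w ρ ψ
  contrajoin v w ρ (∃ᶠ φ)    = ⋁ {I = Lift ℓ ClosedTerm} (λ t → contrajoin v w (lower t ∷ᶠ ρ) φ)
  contrajoin v w ρ (∀ᶠ φ)    = ⋀ {I = Lift ℓ ClosedTerm} (λ t → contrajoin v w (lower t ∷ᶠ ρ) φ)

  -- A program: each predicate letter heads at most one clause
  -- P(x₁,…,xₙ) ← φ(x₁,…,xₙ) (given by its body, if any), and only
  -- finitely many predicate letters head a clause.
  record Program : Set ℓ where
    field
      clause : (p : Pred) → Maybe (Formula (parity p))
      finite : Σ (List Pred) (λ ps → ∀ p → Is-just (clause p) → p ∈ ps)

  data Default : Set where
    dF dT dU dI : Default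

  ⟦_⟧ : Default → Carrier
  ⟦ dF ⟧ = 𝐅
  ⟦ dT ⟧ = 𝐓
  ⟦ dU ⟧ = 𝐔
  ⟦ dI ⟧ = 𝐈

  bodyVal : Default → ∀ {n} → Maybe (Formula n) → Valuation → Valuation →
            (Fin n → ClosedTerm) → Carrier
  bodyVal α nothing  v w ρ = ⟦ α ⟧
  bodyVal α (just φ) v w ρ = contrajoin v w ρ φ

  Ψ : Program → Default → Valuation → Valuation → Valuation
  Ψ P α v w (p , ts) = bodyVal α (Program.clause P p) v w (lookup ts)

  -- Ψ'^α_P(v): the limit of the transfinite iteration from v_α, i.e.
  -- F: ≤t-least, T: ≤t-greatest, U: ≤k-least, I: ≤k-greatest fixpoint of
  -- x ↦ Ψ^α_P(x,v), given by the Knaster–Tarski formula.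
  Ψ' : Program → Default → Valuation → Valuation
  Ψ' P dF v A = ⋀ {I = Σ Valuation (λ x → Ψ P dF x v ≤tᵛ x)} (λ x → proj₁ x A)
  Ψ' P dT v A = ⋁ {I = Σ Valuation (λ x → x ≤tᵛ Ψ P dT x v)} (λ x → proj₁ x A)
  Ψ' P dU v A = ⨂ {I = Σ Valuation (λ x → Ψ P dU x v ≤kᵛ x)} (λ x → proj₁ x A)
  Ψ' P dI v A = ⨁ {I = Σ Valuation (λ x → x ≤kᵛ Ψ P dI x v)} (λ x → proj₁ x A)

-- Ψ'^α_P is ≤t-antitone. It is the least fixpoint of x ↦ Ψ(x,v) in one of
-- the orders ≤t, ≥t, ≤k, ≥k, and by interlacing the joins of each of these are
-- ≤t-monotone; so least fixpoints of ≤t-comparable operators are ≤t-comparable,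
-- and Ψ(x,v') ≤t Ψ(y,v) for x ≤t y, v ≤t v' because negation reverses ≤t.
-- For an antitone f on a complete lattice, f ∘ f is monotone; f swaps the least
-- and the greatest fixpoint of f ∘ f, and each 2-cycle of f consists of
-- fixpoints of f ∘ f.

module Submission where

open import Defs
open import Level using (Level; lower)
open import Function using (flip)
open import Data.Product using (Σ-syntax; _×_; _,_; proj₁; proj₂)
open import Data.Maybe using (just; nothing)
open import Data.Fin using (Fin)
open import Data.Vec using (lookup)
open import Data.Vec.Functional using () renaming (_∷_ to _∷ᶠ_)
open import Relation.Binary.Core using (Rel)
open import Relation.Binary.Definitions using (Reflexive; Transitive)
open import Relation.Binary.PropositionalEquality using (_≡_; subst₂)
  renaming (sym to ≡-sym; trans to ≡-trans)
open import Relation.Binary.Structures using (IsPartialOrder)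
import Relation.Binary.Properties.Poset as PosetProperties
import Relation.Binary.Lattice.Properties.MeetSemilattice as MeetSemilatticeProperties
import Relation.Binary.Lattice.Properties.JoinSemilattice as JoinSemilatticeProperties

⨅-mono : ∀ {ℓ} {C : Set ℓ} {_⊑_ : Rel C ℓ} (⨅ : {I : Set ℓ} → (I → C) → C) →
         Transitive _⊑_ → IsInfimumOf _⊑_ ⨅ → InfMonotone _⊑_ ⨅
⨅-mono ⨅ trans inf a b a⊑b = proj₂ (inf b) _ (λ i → trans (proj₁ (inf a) i) (a⊑b i))

⨆-mono : ∀ {ℓ} {C : Set ℓ} {_⊑_ : Rel C ℓ} (⨆ : {I : Set ℓ} → (I → C) → C) →
         Transitive _⊑_ → IsSupremumOf _⊑_ ⨆ → InfMonotone _⊑_ ⨆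
⨆-mono ⨆ trans sup a b a⊑b = ⨅-mono ⨆ (λ p q → trans q p) sup b a a⊑b

≥-isPartialOrder : ∀ {ℓ} {C : Set ℓ} {_⊑_ : Rel C ℓ} →
                   IsPartialOrder _≡_ _⊑_ → IsPartialOrder _≡_ (flip _⊑_)
≥-isPartialOrder po = PosetProperties.≥-isPartialOrder (record { isPartialOrder = po })

module KnasterTarski {ℓ : Level} {C : Set ℓ} {_⊑_ : Rel C ℓ}
  (⊑-isPartialOrder : IsPartialOrder _≡_ _⊑_)
  {⨅ : {I : Set ℓ} → (I → C) → C} (⨅-inf : IsInfimumOf _⊑_ ⨅)
  (X : Set) where

  open IsPartialOrder ⊑-isPartialOrder

  infix 4 _⊑ᵖ_ _≐ᵖ_

  _⊑ᵖ_ : Rel (X → C) ℓ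
  u ⊑ᵖ v = ∀ A → u A ⊑ v A

  _≐ᵖ_ : Rel (X → C) ℓ
  u ≐ᵖ v = ∀ A → u A ≡ v A

  ⊑ᵖ-trans : ∀ {u v w} → u ⊑ᵖ v → v ⊑ᵖ w → u ⊑ᵖ w
  ⊑ᵖ-trans u⊑v v⊑w A = trans (u⊑v A) (v⊑w A)

  ⊑ᵖ-antisym : ∀ {u v} → u ⊑ᵖ v → v ⊑ᵖ u → u ≐ᵖ v
  ⊑ᵖ-antisym u⊑v v⊑u A = antisym (u⊑v A) (v⊑u A)

  ≐ᵖ⇒⊑ᵖ : ∀ {u v} → u ≐ᵖ v → u ⊑ᵖ v
  ≐ᵖ⇒⊑ᵖ u≐v A = reflexive (u≐v A)

  Monotone : ((X → C) → (X → C)) → Set ℓ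
  Monotone F = ∀ {u v} → u ⊑ᵖ v → F u ⊑ᵖ F v

  lfp : ((X → C) → (X → C)) → X → C
  lfp F A = ⨅ {I = Σ[ u ∈ (X → C) ] F u ⊑ᵖ u} (λ u → proj₁ u A)

  lfp-least : ∀ F {u} → F u ⊑ᵖ u → lfp F ⊑ᵖ u
  lfp-least F F⊑u A = proj₁ (⨅-inf _) (_ , F⊑u)

  lfp-prefixed : ∀ {F} → Monotone F → F (lfp F) ⊑ᵖ lfp F
  lfp-prefixed {F} mono A =
    proj₂ (⨅-inf _) _ (λ (u , Fu⊑u) → trans (mono (lfp-least F Fu⊑u) A) (Fu⊑u A))

  lfp-fixed : ∀ {F} → Monotone F → F (lfp F) ≐ᵖ lfp F
  lfp-fixed {F} mono A =
    antisym (lfp-prefixed mono A) (lfp-least F (mono (lfp-prefixed mono)) A)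

  lfp-least-fixed : ∀ F {u} → F u ≐ᵖ u → lfp F ⊑ᵖ u
  lfp-least-fixed F Fu≐u = lfp-least F (≐ᵖ⇒⊑ᵖ Fu≐u)

  module Interlaced {⨆ : {I : Set ℓ} → (I → C) → C} (⨆-sup : IsSupremumOf _⊑_ ⨆)
    {_≤_ : Rel C ℓ} (⨆-mono-≤ : InfMonotone _≤_ ⨆) where

    _≤ᵖ_ : Rel (X → C) ℓ
    u ≤ᵖ v = ∀ A → u A ≤ v A

    lfp-mono : ∀ {F G} → Monotone F → Monotone G →
               (∀ {u v} → u ≤ᵖ v → F u ≤ᵖ G v) → lfp F ≤ᵖ lfp G
    lfp-mono {F} {G} F-mono G-mono F≤G A =
      subst₂ _≤_ (antisym (r₁⊑ A) (lfp-least F (Fr₁⊑r₁) A))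
                 (antisym (r₂⊑ A) (lfp-least G (Gr₂⊑r₂) A))
                 (r₁≤r₂ A)
      where
      -- The joins r₁, r₂ of all ≤-related pairs below the two least fixpoints
      -- are prefixpoints of F and G, hence equal to those least fixpoints.
      J : Set ℓ
      J = Σ[ (u , v) ∈ (X → C) × (X → C) ] u ≤ᵖ v × u ⊑ᵖ lfp F × v ⊑ᵖ lfp G

      r₁ r₂ : X → C
      r₁ A = ⨆ {I = J} (λ j → proj₁ (proj₁ j) A)
      r₂ A = ⨆ {I = J} (λ j → proj₂ (proj₁ j) A)

      r₁⊑ : r₁ ⊑ᵖ lfp F
      r₁⊑ A = proj₂ (⨆-sup _) _ (λ j → proj₁ (proj₂ (proj₂ j)) A)

      r₂⊑ : r₂ ⊑ᵖ lfp G
      r₂⊑ A = proj₂ (⨆-sup _) _ (λ j → proj₂ (proj₂ (proj₂ j)) A)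

      r₁≤r₂ : r₁ ≤ᵖ r₂
      r₁≤r₂ A = ⨆-mono-≤ _ _ (λ j → proj₁ (proj₂ j) A)

      step : J
      step = (F r₁ , G r₂)
           , F≤G r₁≤r₂
           , (λ A → trans (F-mono r₁⊑ A) (lfp-prefixed F-mono A))
           , (λ A → trans (G-mono r₂⊑ A) (lfp-prefixed G-mono A))

      Fr₁⊑r₁ : F r₁ ⊑ᵖ r₁
      Fr₁⊑r₁ A = proj₁ (⨆-sup (λ j → proj₁ (proj₁ j) A)) step

      Gr₂⊑r₂ : G r₂ ⊑ᵖ r₂
      Gr₂⊑r₂ A = proj₁ (⨆-sup (λ j → proj₂ (proj₁ j) A)) step

module Oscillation {ℓ : Level} {C : Set ℓ} {_⊑_ : Rel C ℓ}
  (⊑-isPartialOrder : IsPartialOrder _≡_ _⊑_)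
  {⨅ : {I : Set ℓ} → (I → C) → C} (⨅-inf : IsInfimumOf _⊑_ ⨅)
  {⨆ : {I : Set ℓ} → (I → C) → C} (⨆-sup : IsSupremumOf _⊑_ ⨆)
  {X : Set} (f : (X → C) → (X → C))
  (f-antitone : ∀ {u v} → (∀ A → u A ⊑ v A) → ∀ A → f v A ⊑ f u A) where

  module Least = KnasterTarski ⊑-isPartialOrder ⨅-inf X
  module Greatest = KnasterTarski (≥-isPartialOrder ⊑-isPartialOrder) ⨆-sup X
  open Least using (_⊑ᵖ_; _≐ᵖ_; ⊑ᵖ-trans; ⊑ᵖ-antisym; ≐ᵖ⇒⊑ᵖ)

  f² : (X → C) → (X → C)
  f² u = f (f u)

  f²-mono : Least.Monotone f²
  f²-mono u⊑v = f-antitone (f-antitone u⊑v)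

  f-resp-≐ᵖ : ∀ {u v} → u ≐ᵖ v → f u ≐ᵖ f v
  f-resp-≐ᵖ u≐v = ⊑ᵖ-antisym (f-antitone (≐ᵖ⇒⊑ᵖ (λ A → ≡-sym (u≐v A))))
                             (f-antitone (≐ᵖ⇒⊑ᵖ u≐v))

  Fix𝐅 Fix𝐓 : X → C
  Fix𝐅 = Least.lfp f²
  Fix𝐓 = Greatest.lfp f²

  Fix𝐅-fixed : f² Fix𝐅 ≐ᵖ Fix𝐅
  Fix𝐅-fixed = Least.lfp-fixed f²-mono

  Fix𝐓-fixed : f² Fix𝐓 ≐ᵖ Fix𝐓
  Fix𝐓-fixed = Greatest.lfp-fixed f²-mono

  Fix𝐅-least : ∀ u → f² u ≐ᵖ u → Fix𝐅 ⊑ᵖ u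
  Fix𝐅-least _ = Least.lfp-least-fixed f²

  Fix𝐓-greatest : ∀ u → f² u ≐ᵖ u → u ⊑ᵖ Fix𝐓
  Fix𝐓-greatest _ = Greatest.lfp-least-fixed f²

  Fix𝐅⊑Fix𝐓 : Fix𝐅 ⊑ᵖ Fix𝐓
  Fix𝐅⊑Fix𝐓 = Fix𝐅-least Fix𝐓 Fix𝐓-fixed

  f-Fix𝐅 : f Fix𝐅 ≐ᵖ Fix𝐓
  f-Fix𝐅 = ⊑ᵖ-antisym (Fix𝐓-greatest (f Fix𝐅) (f-resp-≐ᵖ Fix𝐅-fixed))
                      (⊑ᵖ-trans (≐ᵖ⇒⊑ᵖ (λ A → ≡-sym (Fix𝐓-fixed A)))
                                (f-antitone (Fix𝐅-least (f Fix𝐓) (f-resp-≐ᵖ Fix𝐓-fixed))))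

  f-Fix𝐓 : f Fix𝐓 ≐ᵖ Fix𝐅
  f-Fix𝐓 A = ≡-trans (f-resp-≐ᵖ (λ B → ≡-sym (f-Fix𝐅 B)) A) (Fix𝐅-fixed A)

  two-cycle-oscillates : ∀ {u v} → f u ≐ᵖ v → f v ≐ᵖ u → f² u ≐ᵖ u
  two-cycle-oscillates fu≐v fv≐u A = ≡-trans (f-resp-≐ᵖ fu≐v A) (fv≐u A)

  two-cycle-between : ∀ u v → f u ≐ᵖ v → f v ≐ᵖ u →
    ((Fix𝐅 ⊑ᵖ u) × (u ⊑ᵖ Fix𝐓)) × ((Fix𝐅 ⊑ᵖ v) × (v ⊑ᵖ Fix𝐓))
  two-cycle-between u v fu≐v fv≐u =
    (Fix𝐅-least u u-osc , Fix𝐓-greatest u u-osc) , (Fix𝐅-least v v-osc , Fix𝐓-greatest v v-osc)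
    where
    u-osc : f² u ≐ᵖ u
    u-osc = two-cycle-oscillates fu≐v fv≐u
    v-osc : f² v ≐ᵖ v
    v-osc = two-cycle-oscillates fv≐u fu≐v

module FittingOperator {ℓ : Level} (B : Bilattice ℓ) (S : Signature) where
  open Bilattice B
  open Fitting B S

  private
    module T = IsPartialOrder ≤t-isPartialOrder
    module K = IsPartialOrder ≤k-isPartialOrder

    ∧-mono-t : BinMonotone _≤t_ _∧_
    ∧-mono-t = MeetSemilatticeProperties.∧-monotonic (record
      { isMeetSemilattice = record { isPartialOrder = ≤t-isPartialOrder ; infimum = ∧-inf } })

    ∨-mono-t : BinMonotone _≤t_ _∨_
    ∨-mono-t = JoinSemilatticeProperties.∨-monotonic (record
      { isJoinSemilattice = record { isPartialOrder = ≤t-isPartialOrder ; supremum = ∨-sup } })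

    ⊗-mono-k : BinMonotone _≤k_ _⊗_
    ⊗-mono-k = MeetSemilatticeProperties.∧-monotonic (record
      { isMeetSemilattice = record { isPartialOrder = ≤k-isPartialOrder ; infimum = ⊗-inf } })

    ⊕-mono-k : BinMonotone _≤k_ _⊕_
    ⊕-mono-k = JoinSemilatticeProperties.∨-monotonic (record
      { isJoinSemilattice = record { isPartialOrder = ≤k-isPartialOrder ; supremum = ⊕-sup } })

    ⋀-mono-t : InfMonotone _≤t_ ⋀
    ⋀-mono-t = ⨅-mono ⋀ T.trans ⋀-inf

    ⋁-mono-t : InfMonotone _≤t_ ⋁
    ⋁-mono-t = ⨆-mono ⋁ T.trans ⋁-sup

  -- Phrasing the hypothesis on w through ¬ covers both ≤t, where w has to
  -- decrease, and ≤k, where it has to increase.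
  module ContrajoinMono {_⊑_ : Rel Carrier ℓ} (⊑-refl : Reflexive _⊑_)
    (∧-mono : BinMonotone _⊑_ _∧_) (∨-mono : BinMonotone _⊑_ _∨_)
    (⊗-mono : BinMonotone _⊑_ _⊗_) (⊕-mono : BinMonotone _⊑_ _⊕_)
    (⋀-mono : InfMonotone _⊑_ ⋀) (⋁-mono : InfMonotone _⊑_ ⋁) where

    contrajoin-mono : ∀ {n} {v v' w w' : Valuation} →
      (∀ A → v A ⊑ v' A) → (∀ A → (¬ w A) ⊑ (¬ w' A)) →
      (ρ : Fin n → ClosedTerm) (φ : Formula n) → contrajoin v w ρ φ ⊑ contrajoin v' w' ρ φ
    contrajoin-mono v⊑v' w⊑w' ρ (pos (pred p ts)) = v⊑v' _
    contrajoin-mono v⊑v' w⊑w' ρ (pos (equal s t)) = ⊑-refl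
    contrajoin-mono v⊑v' w⊑w' ρ (neg (pred p ts)) = w⊑w' _
    contrajoin-mono v⊑v' w⊑w' ρ (neg (equal s t)) = ⊑-refl
    contrajoin-mono v⊑v' w⊑w' ρ (const b) = ⊑-refl
    contrajoin-mono v⊑v' w⊑w' ρ (φ ∧ᶠ ψ) =
      ∧-mono (contrajoin-mono v⊑v' w⊑w' ρ φ) (contrajoin-mono v⊑v' w⊑w' ρ ψ)
    contrajoin-mono v⊑v' w⊑w' ρ (φ ∨ᶠ ψ) =
      ∨-mono (contrajoin-mono v⊑v' w⊑w' ρ φ) (contrajoin-mono v⊑v' w⊑w' ρ ψ)
    contrajoin-mono v⊑v' w⊑w' ρ (φ ⊗ᶠ ψ) =
      ⊗-mono (contrajoin-mono v⊑v' w⊑w' ρ φ) (contrajoin-mono v⊑v' w⊑w' ρ ψ)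
    contrajoin-mono v⊑v' w⊑w' ρ (φ ⊕ᶠ ψ) =
      ⊕-mono (contrajoin-mono v⊑v' w⊑w' ρ φ) (contrajoin-mono v⊑v' w⊑w' ρ ψ)
    contrajoin-mono v⊑v' w⊑w' ρ (∃ᶠ φ) =
      ⋁-mono _ _ (λ t → contrajoin-mono v⊑v' w⊑w' (lower t ∷ᶠ ρ) φ)
    contrajoin-mono v⊑v' w⊑w' ρ (∀ᶠ φ) =
      ⋀-mono _ _ (λ t → contrajoin-mono v⊑v' w⊑w' (lower t ∷ᶠ ρ) φ)

    Ψ-mono : ∀ P α {v v' w w' : Valuation} →
      (∀ A → v A ⊑ v' A) → (∀ A → (¬ w A) ⊑ (¬ w' A)) → ∀ A → Ψ P α v w A ⊑ Ψ P α v' w' A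
    Ψ-mono P α v⊑v' w⊑w' (p , ts) with Program.clause P p
    ... | nothing = ⊑-refl
    ... | just φ  = contrajoin-mono v⊑v' w⊑w' (lookup ts) φ

  private
    module Mono-t = ContrajoinMono {_⊑_ = _≤t_} T.refl
                      ∧-mono-t ∨-mono-t ⊗-mono-t ⊕-mono-t ⋀-mono-t ⋁-mono-t
    module Mono-k = ContrajoinMono {_⊑_ = _≤k_} K.refl
                      ∧-mono-k ∨-mono-k ⊗-mono-k ⊕-mono-k ⋀-mono-k ⋁-mono-k

  Ψ-mono-t : ∀ P α {v v' w w'} → v ≤tᵛ v' → w' ≤tᵛ w → Ψ P α v w ≤tᵛ Ψ P α v' w'
  Ψ-mono-t P α v≤v' w'≤w = Mono-t.Ψ-mono P α v≤v' (λ A → ¬-antitone-t (w'≤w A))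

  Ψ-monoˡ-t : ∀ P α {w v v'} → v ≤tᵛ v' → Ψ P α v w ≤tᵛ Ψ P α v' w
  Ψ-monoˡ-t P α v≤v' = Ψ-mono-t P α v≤v' (λ _ → T.refl)

  Ψ-mono-k : ∀ P α {v v' w w'} → v ≤kᵛ v' → w ≤kᵛ w' → Ψ P α v w ≤kᵛ Ψ P α v' w'
  Ψ-mono-k P α v≤v' w≤w' = Mono-k.Ψ-mono P α v≤v' (λ A → ¬-monotone-k (w≤w' A))

  Ψ-monoˡ-k : ∀ P α {w v v'} → v ≤kᵛ v' → Ψ P α v w ≤kᵛ Ψ P α v' w
  Ψ-monoˡ-k P α v≤v' = Ψ-mono-k P α v≤v' (λ _ → K.refl)

  private
    module Lfpₜ = KnasterTarski.Interlaced ≤t-isPartialOrder ⋀-inf GroundAtom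
                    ⋁-sup {_≤_ = _≤t_} ⋁-mono-t
    module Gfpₜ = KnasterTarski.Interlaced (≥-isPartialOrder ≤t-isPartialOrder) ⋁-sup GroundAtom
                    ⋀-inf {_≤_ = _≤t_} ⋀-mono-t
    module Lfpₖ = KnasterTarski.Interlaced ≤k-isPartialOrder ⨂-inf GroundAtom
                    ⨁-sup {_≤_ = _≤t_} ⨁-mono-t
    module Gfpₖ = KnasterTarski.Interlaced (≥-isPartialOrder ≤k-isPartialOrder) ⨁-sup GroundAtom
                    ⨂-inf {_≤_ = _≤t_} ⨂-mono-t

  -- Ψ' P α v is by definition the least fixpoint of Ψ P α · v for the order
  -- ≤t, ≥t, ≤k or ≥k selected by α; in each of these the joins are
  -- ≤t-monotone, which is all the comparison of fixpoints needs.
  Ψ'-antitone : ∀ P α {v v'} → v ≤tᵛ v' → Ψ' P α v' ≤tᵛ Ψ' P α v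
  Ψ'-antitone P dF v≤v' =
    Lfpₜ.lfp-mono (Ψ-monoˡ-t P dF) (Ψ-monoˡ-t P dF)
      (λ u≤u' → Ψ-mono-t P dF u≤u' v≤v')
  Ψ'-antitone P dT v≤v' =
    Gfpₜ.lfp-mono (Ψ-monoˡ-t P dT) (Ψ-monoˡ-t P dT)
      (λ u≤u' → Ψ-mono-t P dT u≤u' v≤v')
  Ψ'-antitone P dU v≤v' =
    Lfpₖ.lfp-mono (Ψ-monoˡ-k P dU) (Ψ-monoˡ-k P dU)
      (λ u≤u' → Ψ-mono-t P dU u≤u' v≤v')
  Ψ'-antitone P dI v≤v' =
    Gfpₖ.lfp-mono (Ψ-monoˡ-k P dI) (Ψ-monoˡ-k P dI)
      (λ u≤u' → Ψ-mono-t P dI u≤u' v≤v')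

proposition2 : ∀ {ℓ : Level} (B : Bilattice ℓ) (S : Signature)
    (P : Fitting.Program B S) (α : Fitting.Default B S) →
    let open Fitting B S
        f = Ψ' P α
    in Σ[ FixF ∈ Valuation ] Σ[ FixT ∈ Valuation ]
         (FixF ≤tᵛ FixT)
       × (f (f FixF) ≐ FixF)
       × (∀ x → f (f x) ≐ x → FixF ≤tᵛ x)
       × (f (f FixT) ≐ FixT)
       × (∀ x → f (f x) ≐ x → x ≤tᵛ FixT)
       × (f FixF ≐ FixT)
       × (f FixT ≐ FixF)
       × (∀ x y → f x ≐ y → f y ≐ x →
            ((FixF ≤tᵛ x) × (x ≤tᵛ FixT)) × ((FixF ≤tᵛ y) × (y ≤tᵛ FixT)))
proposition2 B S P α =
  Fix𝐅 , Fix𝐓 , Fix𝐅⊑Fix𝐓 , Fix𝐅-fixed , Fix𝐅-least , Fix𝐓-fixed , Fix𝐓-greatest ,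
  f-Fix𝐅 , f-Fix𝐓 , two-cycle-between
  where
  open Bilattice B using (≤t-isPartialOrder; ⋀-inf; ⋁-sup)
  open Oscillation ≤t-isPartialOrder ⋀-inf ⋁-sup (Fitting.Ψ' B S P α)
                   (FittingOperator.Ψ'-antitone B S P α)
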